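{- Let $\alpha$ be a positive rational number and let $\mathcal T_1,\mathcal T_2$ be factorization trees for $\alpha$ with $\mathcal T_1\cong\mathcal T_2$. If $\mathcal G_1$ and $\mathcal G_2$ are measure class graphs for $\mathcal T_1$ and $\mathcal T_2$, respectively, then $\mathcal G_1\cong\mathcal G_2$.
   Context: Write $\alpha=a/b$ with $a,b$ coprime positive integers. Let $p_1\ge\cdots\ge p_N$ be the primes dividing $ab$, listed with multiplicity. Put $\gamma(i)=1$ if $p_i\mid a$, $\gamma(i)=-1$ if $p_i\mid b$, and $\alpha_n=\prod_{i=1}^n p_i^{\gamma(i)}$ for $0\le n\le N$. A factorization of a positive rational $\beta$ is a sequence $(a_1/b_1,a_2/b_2,\dots)$ with $a_i,b_i$ positive integers, $a_i=b_i=1$ for all but finitely many $i$, $\prod_i a_i/b_i=\beta$, $\max\{a_i,b_i\}\ge\max\{a_{i+1},b_{i+1}\}$ for all $i$, and $\gcd(a_i,b_j)=1$ for all $i,j$. Let $\mathfrak F_\alpha$ be the set of factorizations of $\alpha_n$, $0\le n\le N$. For $0\le n<N$, a factorization $(a_i/b_i)$ of $\alpha_n$ is a direct subfactorization of a factorization $(c_i/d_i)$ of $\alpha_{n+1}$ if either $p_{n+1}\mid a$ and for some $k$: $d_i=b_i$ for all $i$, $c_i=a_i$ for $i\ne k$, $c_k=a_kp_{n+1}$; or $p_{n+1}\mid b$ and for some $k$: $c_i=a_i$ for all $i$, $d_i=b_i$ for $i\ne k$, $d_k=b_kp_{n+1}$. A digraph data structure for a set $X$ is a pair $(G,\mu)$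 with $G$ a digraph and $\mu:V(G)\to X$ a map. A factorization tree for $\alpha$ is a digraph data structure $(T,\nu)$ for $\mathfrak F_\alpha$ where $T$ is a rooted tree with edges from each vertex to its children, with parenting map $\phi$, such that: (1) root $r_0$ has $\nu(r_0)=(1,1,\dots)$; (2) if $n<N$ and $\nu(r)$ is a factorization of $\alpha_n$ then $r$ has a child; (3) $\nu(r)=\nu(s)$ and $\phi(r)=\phi(s)$ imply $r=s$; (4) for non-root $r$, $\nu(\phi(r))$ is a direct subfactorization of $\nu(r)$. For $\mathbf A=(a_1/b_1,a_2/b_2,\dots)$ set $m(\mathbf A)=(\log\max\{a_1,b_1\},\log\max\{a_2,b_2\},\dots)$. Two elements $\mathbf A,\mathbf B$ of $\mathfrak F_\alpha$ are measure equivalent, $\mathbf A\sim\mathbf B$, if they are factorizations of the same rational number and $m(\mathbf A)=m(\mathbf B)$. Let $\overline{\mathfrak F}_\alpha$ be the set of equivalence classes $[\mathbf A]$ and $f:\mathfrak F_\alpha\to\overline{\mathfrak F}_\alpha$, $f(\mathbf A)=[\mathbf A]$. A measure class graph for a factorization tree $\mathcal T=(T,\nu)$ is a digraph data structure $\mathcal G=(G,\mu)$ for $\overline{\mathfrak F}_\alpha$ such that $\mu$ is injective and there exists a surjective map $\pi:V(T)\to V(G)$ with: $(\pi(r),\pi(s))\in E(G)$ whenever $(r,s)\in E(T)$; $\mu(\pi(r))=f(\nu(r))$ for all $r$; and (faithfulness) for all $g,h\in\pi(V(T))$ with $(g,h)\in E(G)$ there is $(r,s)\in E(T)$ with $(\pi(r),\pi(s))=(g,h)$.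 For digraph data structures $(G_1,\mu_1),(G_2,\mu_2)$ for the same set, an isomorphism is a bijection $\tau:V(G_1)\to V(G_2)$ with $\mu_2\circ\tau=\mu_1$ and $(g,h)\in E(G_1)\iff(\tau(g),\tau(h))\in E(G_2)$; $\cong$ means one exists (this applies both to factorization trees and to measure class graphs). -}

module Defs where

open import Data.Nat using (ℕ; zero; suc; _*_; _≤_; _<_; _≥_; _⊔_)
open import Data.Nat.Divisibility using (_∣_; _∣?_)
open import Data.Nat.Coprimality using (Coprime)
open import Data.Product using (Σ; ∃; ∃-syntax; _×_; _,_; proj₁; proj₂)
open import Data.Sum using (_⊎_)
open import Data.List using (List; []; _∷_; take; filter; length)
open import Data.Nat.ListAction using (product)
open import Relation.Nullary using (¬_)
open import Relation.Binary.PropositionalEquality using (_≡_; _≢_)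

-- Sequences (a₁/b₁, a₂/b₂, …) are functions ℕ → ℕ × ℕ (index 0 = first
-- term); equality of sequences is pointwise equality.

Seq : Set
Seq = ℕ → ℕ × ℕ

_≗ˢ_ : Seq → Seq → Set
A ≗ˢ B = ∀ i → A i ≡ B i

ones : Seq
ones _ = (1 , 1)

mx : ℕ × ℕ → ℕ
mx (x , y) = x ⊔ y

prodNum : Seq → ℕ → ℕ
prodNum A zero    = 1
prodNum A (suc L) = prodNum A L * proj₁ (A L)

prodDen : Seq → ℕ → ℕ
prodDen A zero    = 1
prodDen A (suc L) = prodDen A L * proj₂ (A L)

IsFactorizationOf : ℕ → ℕ → Seq → Set
IsFactorizationOf c d A =
  (∀ i → 1 ≤ proj₁ (A i) × 1 ≤ proj₂ (A i))
  × (∃[ L ] ((∀ i → L ≤ i → A i ≡ (1 , 1))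
             × prodNum A L * d ≡ prodDen A L * c))
  × (∀ i → mx (A (suc i)) ≤ mx (A i))
  × (∀ i j → Coprime (proj₁ (A i)) (proj₂ (A j)))

-- The data attached to α = a/b : ps = (p₁ ≥ … ≥ p_N), the primes of ab.

-- p_{n+1} (0-based lookup, default 1 out of range)
nth : List ℕ → ℕ → ℕ
nth []       _       = 1
nth (x ∷ xs) zero    = x
nth (x ∷ xs) (suc n) = nth xs n

-- α_n = num n / den n : product of the pᵢ^{γ(i)}, i ≤ n
-- (γ(i) = 1 iff pᵢ ∣ a)
alphaNum : (a : ℕ) → List ℕ → ℕ → ℕ
alphaNum a ps n = product (filter (λ p → p ∣? a) (take n ps))

alphaDen : (a : ℕ) → List ℕ → ℕ → ℕ
alphaDen a ps n = product (filter (λ p → ¬? (p ∣? a)) (take n ps))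
  where open import Relation.Nullary.Decidable using (¬?)

IsFact : (a : ℕ) → List ℕ → ℕ → Seq → Set
IsFact a ps n A = IsFactorizationOf (alphaNum a ps n) (alphaDen a ps n) A

InF : (a : ℕ) → List ℕ → Seq → Set
InF a ps A = ∃[ n ] (n ≤ length ps × IsFact a ps n A)

DirectSub : (a b : ℕ) → List ℕ → ℕ → Seq → Seq → Set
DirectSub a b ps n A C =
  n < length ps × IsFact a ps n A × IsFact a ps (suc n) C ×
  ( (nth ps n ∣ a × ∃[ k ] ((∀ i → proj₂ (C i) ≡ proj₂ (A i))
                           × (∀ i → i ≢ k → proj₁ (C i) ≡ proj₁ (A i))
                           × proj₁ (C k) ≡ proj₁ (A k) * nth ps n))
  ⊎ (nth ps n ∣ b × ∃[ k ] ((∀ i → proj₁ (C i) ≡ proj₁ (A i))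
                           × (∀ i → i ≢ k → proj₂ (C i) ≡ proj₂ (A i))
                           × proj₂ (C k) ≡ proj₂ (A k) * nth ps n)) )

-- measure equivalence (m(A) = m(B) ⇔ max-sequences agree, log injective)
MeasEq : (a : ℕ) → List ℕ → Seq → Seq → Set
MeasEq a ps A B =
  (∃[ n ] (n ≤ length ps × IsFact a ps n A × IsFact a ps n B))
  × (∀ i → mx (A i) ≡ mx (B i))

iter : {V : Set} → (V → V) → ℕ → V → V
iter f zero    v = v
iter f (suc k) v = f (iter f k v)

-- Factorization trees: a digraph data structure (V, E, ν) for 𝔉_α which
-- is a rooted tree (edges parent → child) with parenting map `parent`
-- (its value at the root is irrelevant), satisfying (1)–(4).

record FactTree (a b : ℕ) (ps : List ℕ) : Set₁ where
  field
    V      : Set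
    E      : V → V → Set
    ν      : V → Seq
    ν∈F    : ∀ v → InF a ps (ν v)
    root   : V
    parent : V → V
    edge→  : ∀ u v → E u v → (v ≢ root × parent v ≡ u)
    →edge  : ∀ u v → v ≢ root → parent v ≡ u → E u v
    reach  : ∀ v → ∃[ k ] (iter parent k v ≡ root)
    cond1  : ν root ≗ˢ ones
    cond2  : ∀ r n → n < length ps → IsFact a ps n (ν r) → ∃[ s ] E r s
    cond3  : ∀ r s → r ≢ root → s ≢ root →
             ν r ≗ˢ ν s → parent r ≡ parent s → r ≡ s
    cond4  : ∀ r → r ≢ root → ∃[ n ] DirectSub a b ps n (ν (parent r)) (ν r)

TreeIso : ∀ {a b ps} → FactTree a b ps → FactTree a b ps → Set
TreeIso T₁ T₂ =
  Σ (T₁.V → T₂.V) λ τ →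
    (∀ x y → τ x ≡ τ y → x ≡ y) × (∀ y → ∃[ x ] (τ x ≡ y))
    × (∀ g → T₂.ν (τ g) ≗ˢ T₁.ν g)
    × (∀ g h → (T₁.E g h → T₂.E (τ g) (τ h)) × (T₂.E (τ g) (τ h) → T₁.E g h))
  where module T₁ = FactTree T₁
        module T₂ = FactTree T₂

-- Measure class graphs.  An element [A] of the quotient 𝔉̄_α is
-- represented by a representative A ∈ 𝔉_α; equality of classes is MeasEq.

record MCG {a b : ℕ} {ps : List ℕ} (T : FactTree a b ps) : Set₁ where
  module T = FactTree T
  field
    V      : Set
    E      : V → V → Set
    μ      : V → Seq
    μ∈F    : ∀ g → InF a ps (μ g)
    μ-inj  : ∀ g h → MeasEq a ps (μ g) (μ h) → g ≡ h
    π      : T.V → V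
    π-surj : ∀ g → ∃[ r ] (π r ≡ g)
    π-edge : ∀ r s → T.E r s → E (π r) (π s)
    π-lab  : ∀ r → MeasEq a ps (μ (π r)) (T.ν r)
    faithful : ∀ g h → (∃[ r ] (π r ≡ g)) → (∃[ s ] (π s ≡ h)) → E g h →
               ∃[ r ] ∃[ s ] (T.E r s × π r ≡ g × π s ≡ h)

MCGIso : ∀ {a b ps} {T₁ T₂ : FactTree a b ps} → MCG T₁ → MCG T₂ → Set
MCGIso {a = a} {ps = ps} G₁ G₂ =
  Σ (G₁.V → G₂.V) λ τ →
    (∀ x y → τ x ≡ τ y → x ≡ y) × (∀ y → ∃[ x ] (τ x ≡ y))
    × (∀ g → MeasEq a ps (G₂.μ (τ g)) (G₁.μ g))
    × (∀ g h → (G₁.E g h → G₂.E (τ g) (τ h)) × (G₂.E (τ g) (τ h) → G₁.E g h))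
  where module G₁ = MCG G₁
        module G₂ = MCG G₂

module Submission where

-- A measure class graph G of a factorization tree T is a
-- quotient of the digraph T: the projection π is surjective, maps edges to
-- edges, and (faithfulness) every edge of G is the image of a tree edge.
-- Its fibres are exactly the measure classes, because μ is injective up to
-- measure equivalence and μ (π r) is measure equivalent to ν r.
--
-- It then shows that measure equivalence is symmetric
-- and transitive (transitivity needs that a factorization determines the
-- rational number it factorizes), which yields the fibre description.
-- For the theorem, apply the graph fact to ρ₁ = π₁ and ρ₂ = π₂ ∘ τ on the
-- tree T₁, where τ : T₁ ≅ T₂: both have as kernel measure equivalence of
-- the ν₁-labels, and σ respects labels up to measure equivalence.

open import Defs
open import Data.Nat using (ℕ; zero; suc; _*_; _+_; _∸_; _<_; _≥_; _≤_; NonZero; >-nonZero)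
open import Data.Nat.Properties
  using (*-identityʳ; *-cancelʳ-≡; *-mono-≤; m*n≢0; m≤n+m; m∸n+n≡m; ≤-refl; ≤-total)
open import Data.Nat.Coprimality using (Coprime)
open import Data.Nat.Primality using (Prime; prime⇒nonZero)
open import Data.Nat.Divisibility using (_∣?_)
open import Data.Nat.ListAction using (product)
open import Data.Nat.ListAction.Properties using (product≢0)
open import Data.List using (List; take; filter)
open import Data.List.Relation.Unary.All using (All)
import Data.List.Relation.Unary.All as All
open import Data.List.Relation.Unary.All.Properties using (take⁺; filter⁺)
open import Data.List.Relation.Unary.Linked using (Linked)
open import Data.Product using (∃-syntax; _×_; _,_; proj₁; proj₂)
open import Data.Sum using (inj₁; inj₂)
open import Relation.Nullary.Decidable using (¬?)
open import Relation.Binary.PropositionalEquality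
  using (_≡_; refl; sym; trans; cong; cong₂; subst; subst₂; module ≡-Reasoning)

record IsGraphQuotient {X V : Set} (E_X : X → X → Set) (E : V → V → Set)
                       (ρ : X → V) : Set where
  field
    onto : ∀ g → ∃[ x ] (ρ x ≡ g)
    push : ∀ x y → E_X x y → E (ρ x) (ρ y)
    lift : ∀ g h → E g h → ∃[ x ] ∃[ y ] (E_X x y × ρ x ≡ g × ρ y ≡ h)

-- Two quotients of the same digraph with the same kernel are isomorphic,
-- via the map σ determined by σ ∘ ρ₁ = ρ₂.
module SameKernel {X V₁ V₂ : Set} {E_X : X → X → Set}
         {E₁ : V₁ → V₁ → Set} {E₂ : V₂ → V₂ → Set}
         {ρ₁ : X → V₁} {ρ₂ : X → V₂}
         (Q₁ : IsGraphQuotient E_X E₁ ρ₁) (Q₂ : IsGraphQuotient E_X E₂ ρ₂)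
         (kernel⊆ : ∀ x y → ρ₁ x ≡ ρ₁ y → ρ₂ x ≡ ρ₂ y)
         (kernel⊇ : ∀ x y → ρ₂ x ≡ ρ₂ y → ρ₁ x ≡ ρ₁ y) where
  module Q₁ = IsGraphQuotient Q₁
  module Q₂ = IsGraphQuotient Q₂

  rep : V₁ → X
  rep g = proj₁ (Q₁.onto g)

  rep-spec : ∀ g → ρ₁ (rep g) ≡ g
  rep-spec g = proj₂ (Q₁.onto g)

  σ : V₁ → V₂
  σ g = ρ₂ (rep g)

  σ∘ρ₁ : ∀ x → σ (ρ₁ x) ≡ ρ₂ x
  σ∘ρ₁ x = kernel⊆ (rep (ρ₁ x)) x (rep-spec (ρ₁ x))

  σ-injective : ∀ g h → σ g ≡ σ h → g ≡ h
  σ-injective g h e =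
    trans (sym (rep-spec g)) (trans (kernel⊇ (rep g) (rep h) e) (rep-spec h))

  σ-surjective : ∀ h → ∃[ g ] (σ g ≡ h)
  σ-surjective h with Q₂.onto h
  ... | x , ρ₂x≡h = ρ₁ x , trans (σ∘ρ₁ x) ρ₂x≡h

  σ-preserves : ∀ g h → E₁ g h → E₂ (σ g) (σ h)
  σ-preserves g h e with Q₁.lift g h e
  ... | x , y , exy , refl , refl =
    subst₂ E₂ (sym (σ∘ρ₁ x)) (sym (σ∘ρ₁ y)) (Q₂.push x y exy)

  σ-reflects : ∀ g h → E₂ (σ g) (σ h) → E₁ g h
  σ-reflects g h e with Q₂.lift (σ g) (σ h) e
  ... | x , y , exy , ρ₂x≡σg , ρ₂y≡σh =
    subst₂ E₁ (σ-injective _ _ (trans (σ∘ρ₁ x) ρ₂x≡σg))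
              (σ-injective _ _ (trans (σ∘ρ₁ y) ρ₂y≡σh))
              (Q₁.push x y exy)

module Fibres {L V X : Set} (_~_ : L → L → Set)
         (~-sym : ∀ {u v} → u ~ v → v ~ u)
         (~-trans : ∀ {u v w} → u ~ v → v ~ w → u ~ w)
         (μ : V → L) (μ-inj : ∀ g h → μ g ~ μ h → g ≡ h)
         (ℓ : X → L) (ρ : X → V) (ρ-lab : ∀ x → μ (ρ x) ~ ℓ x) where

  fibre⇒~ : ∀ x y → ρ x ≡ ρ y → ℓ x ~ ℓ y
  fibre⇒~ x y e = ~-trans (~-sym (ρ-lab x)) (subst (λ g → μ g ~ ℓ y) (sym e) (ρ-lab y))

  ~⇒fibre : ∀ x y → ℓ x ~ ℓ y → ρ x ≡ ρ y
  ~⇒fibre x y m = μ-inj _ _ (~-trans (ρ-lab x) (~-trans m (~-sym (ρ-lab y))))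

prodNum-cong : ∀ {A B} → A ≗ˢ B → ∀ L → prodNum A L ≡ prodNum B L
prodNum-cong e zero    = refl
prodNum-cong e (suc L) = cong₂ _*_ (prodNum-cong e L) (cong proj₁ (e L))

prodDen-cong : ∀ {A B} → A ≗ˢ B → ∀ L → prodDen A L ≡ prodDen B L
prodDen-cong e zero    = refl
prodDen-cong e (suc L) = cong₂ _*_ (prodDen-cong e L) (cong proj₂ (e L))

OnesFrom : Seq → ℕ → Set
OnesFrom A L = ∀ i → L ≤ i → A i ≡ (1 , 1)

products-stable : ∀ A L → OnesFrom A L → ∀ k →
                  prodNum A (k + L) ≡ prodNum A L × prodDen A (k + L) ≡ prodDen A L
products-stable A L ones zero = refl , refl
products-stable A L ones (suc k) rewrite ones (k + L) (m≤n+m L k) =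
  let (num , den) = products-stable A L ones k
  in trans (*-identityʳ _) num , trans (*-identityʳ _) den

products-agree : ∀ A L L' → OnesFrom A L → OnesFrom A L' →
                 prodNum A L' ≡ prodNum A L × prodDen A L' ≡ prodDen A L
products-agree A L L' ones ones' with ≤-total L L'
... | inj₁ L≤L' rewrite sym (m∸n+n≡m L≤L') = products-stable A L ones (L' ∸ L)
... | inj₂ L'≤L rewrite sym (m∸n+n≡m L'≤L) =
  let (num , den) = products-stable A L' ones' (L ∸ L') in sym num , sym den

prodNum-positive : ∀ A → (∀ i → 1 ≤ proj₁ (A i) × 1 ≤ proj₂ (A i)) → ∀ L → 1 ≤ prodNum A L
prodNum-positive A pos zero    = ≤-refl
prodNum-positive A pos (suc L) = *-mono-≤ (prodNum-positive A pos L) (proj₁ (pos L))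

factorization-cong : ∀ {c d A B} → A ≗ˢ B → IsFactorizationOf c d A → IsFactorizationOf c d B
factorization-cong {c} {d} e (pos , (L , ones , eq) , mono , cop) =
  (λ i → subst (λ z → 1 ≤ proj₁ z × 1 ≤ proj₂ z) (e i) (pos i))
  , (L , (λ i le → trans (sym (e i)) (ones i le))
       , subst₂ (λ u v → u * d ≡ v * c) (prodNum-cong e L) (prodDen-cong e L) eq)
  , (λ i → subst₂ (λ u v → mx u ≤ mx v) (e (suc i)) (e i) (mono i))
  , (λ i j → subst₂ (λ u v → Coprime (proj₁ u) (proj₂ v)) (e i) (e j) (cop i j))

equal-ratios : ∀ x y p q c d c' d' → .{{_ : NonZero (p * d)}} →
               p * d ≡ q * c → p * d' ≡ q * c' → x * d ≡ y * c → x * d' ≡ y * c'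
equal-ratios x y p q c d c' d' pc pc' xc = *-cancelʳ-≡ (x * d') (y * c') (p * d) (begin
    x * d' * (p * d)   ≡⟨ solve 4 (λ x d' p d → x :* d' :* (p :* d) := (x :* d) :* (p :* d')) refl x d' p d ⟩
    (x * d) * (p * d') ≡⟨ cong₂ _*_ xc pc' ⟩
    (y * c) * (q * c') ≡⟨ solve 4 (λ y c q c' → (y :* c) :* (q :* c') := (y :* c') :* (q :* c)) refl y c q c' ⟩
    (y * c') * (q * c) ≡⟨ cong ((y * c') *_) (sym pc) ⟩
    y * c' * (p * d)   ∎)
  where open ≡-Reasoning
        open import Data.Nat.Solver using (module +-*-Solver)
        open +-*-Solver

factorizes-same-rational : ∀ {c d c' d' A X} → .{{_ : NonZero d}} →
  IsFactorizationOf c d A → IsFactorizationOf c' d' A →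
  IsFactorizationOf c d X → IsFactorizationOf c' d' X
factorizes-same-rational {c} {d} {c'} {d'} {A} {X}
  (pos , (L , ones , eq) , _) (_ , (L' , ones' , eq') , _) (posX , (K , onesX , eqX) , monoX , copX) =
  posX , (K , onesX , equal-ratios (prodNum X K) (prodDen X K) (prodNum A L) (prodDen A L)
                        c d c' d' {{m*n≢0 _ _ {{>-nonZero (prodNum-positive A pos L)}}}}
                        eq eqL eqX) , monoX , copX
  where
  eqL : prodNum A L * d' ≡ prodDen A L * c'
  eqL with products-agree A L L' ones ones'
  ... | num , den = subst₂ (λ u v → u * d' ≡ v * c') num den eq'

module Measure (a : ℕ) (ps : List ℕ) (primes : All Prime ps) where

  alphaDen≢0 : ∀ n → NonZero (alphaDen a ps n)
  alphaDen≢0 n =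
    product≢0 (filter⁺ (λ p → ¬? (p ∣? a)) (take⁺ n (All.map prime⇒nonZero primes)))

  ~-sym : ∀ {A B} → MeasEq a ps A B → MeasEq a ps B A
  ~-sym ((n , n≤N , fA , fB) , m) = (n , n≤N , fB , fA) , (λ i → sym (m i))

  ~-trans : ∀ {A B C} → MeasEq a ps A B → MeasEq a ps B C → MeasEq a ps A C
  ~-trans ((n , n≤N , fA , fB) , m) ((n' , _ , fB' , fC) , m') =
    (n , n≤N , fA , factorizes-same-rational {{alphaDen≢0 n'}} fB' fB fC)
    , (λ i → trans (m i) (m' i))

  ~-congʳ : ∀ {A B B'} → MeasEq a ps A B → B ≗ˢ B' → MeasEq a ps A B'
  ~-congʳ ((n , n≤N , fA , fB) , m) e =
    (n , n≤N , fA , factorization-cong e fB) , (λ i → trans (m i) (cong mx (e i)))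

π-quotient : ∀ {a b ps} {T : FactTree a b ps} (G : MCG T) →
             IsGraphQuotient (FactTree.E T) (MCG.E G) (MCG.π G)
π-quotient G = record
  { onto = π-surj
  ; push = π-edge
  ; lift = λ g h e → faithful g h (π-surj g) (π-surj h) e
  }
  where open MCG G

quotient-∘-iso : ∀ {a b ps} {T₁ T₂ : FactTree a b ps} {V : Set} {E : V → V → Set} {ρ : FactTree.V T₂ → V} →
                 ((τ , _) : TreeIso T₁ T₂) →
                 IsGraphQuotient (FactTree.E T₂) E ρ →
                 IsGraphQuotient (FactTree.E T₁) E (λ r → ρ (τ r))
quotient-∘-iso {T₁ = T₁} {E = E} {ρ = ρ} (τ , _ , τ-onto , _ , τ-edge) Q = record
  { onto = λ g → let (r₂ , ρr₂≡g) = onto g ; (r , τr≡r₂) = τ-onto r₂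
                 in r , trans (cong ρ τr≡r₂) ρr₂≡g
  ; push = λ r s e → push (τ r) (τ s) (proj₁ (τ-edge r s) e)
  ; lift = lift-along-τ
  }
  where
  open IsGraphQuotient Q
  lift-along-τ : ∀ g h → E g h →
                 ∃[ r ] ∃[ s ] (FactTree.E T₁ r s × ρ (τ r) ≡ g × ρ (τ s) ≡ h)
  lift-along-τ g h e with lift g h e
  ... | r₂ , s₂ , e₂ , ρr₂≡g , ρs₂≡h with τ-onto r₂ | τ-onto s₂
  ... | r , refl | s , refl = r , s , proj₂ (τ-edge r s) e₂ , ρr₂≡g , ρs₂≡h

theorem2p11 : (a b : ℕ) → 0 < a → 0 < b → Coprime a b →
              (ps : List ℕ) → All Prime ps → Linked _≥_ ps → product ps ≡ a * b →
              (T₁ T₂ : FactTree a b ps) → TreeIso T₁ T₂ →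
              (G₁ : MCG T₁) (G₂ : MCG T₂) → MCGIso G₁ G₂
theorem2p11 a b _ _ _ ps primes _ _ T₁ T₂ iso@(τ , _ , _ , τ-lab , _) G₁ G₂ =
  σ , σ-injective , σ-surjective , σ-lab , λ g h → σ-preserves g h , σ-reflects g h
  where
  open Measure a ps primes
  module G₁ = MCG G₁
  module G₂ = MCG G₂

  π₂τ-lab : ∀ r → MeasEq a ps (G₂.μ (G₂.π (τ r))) (FactTree.ν T₁ r)
  π₂τ-lab r = ~-congʳ (G₂.π-lab (τ r)) (τ-lab r)

  module F₁ = Fibres (MeasEq a ps) ~-sym ~-trans G₁.μ G₁.μ-inj (FactTree.ν T₁) G₁.π G₁.π-lab
  module F₂ = Fibres (MeasEq a ps) ~-sym ~-trans G₂.μ G₂.μ-inj (FactTree.ν T₁) (λ r → G₂.π (τ r)) π₂τ-lab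

  open SameKernel (π-quotient G₁) (quotient-∘-iso {T₁ = T₁} {T₂ = T₂} iso (π-quotient G₂))
         (λ r s e → F₂.~⇒fibre r s (F₁.fibre⇒~ r s e))
         (λ r s e → F₁.~⇒fibre r s (F₂.fibre⇒~ r s e))

  σ-lab : ∀ g → MeasEq a ps (G₂.μ (σ g)) (G₁.μ g)
  σ-lab g = subst (λ h → MeasEq a ps (G₂.μ (σ g)) (G₁.μ h)) (rep-spec g)
              (~-trans (π₂τ-lab (rep g)) (~-sym (G₁.π-lab (rep g))))
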